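{- Let $n\geq 3$ be an integer and $J$ a $\phi_n$-injective quiver with $V(J)\neq\emptyset$. Then $J$ is loaded if and only if $J$ is weakly connected and has at least one vertex with a loop.
   Context: A quiver is a quadruple $(V,E,\sigma,\tau)$ with $V,E$ sets and $\sigma,\tau:E\to V$ functions (source and target). For $v,w\in V(J)$, $\mathrm{edges}_J(v,w):=\sigma_J^{ -1}(v)\cap\tau_J^{ -1}(w)$. $J$ is loaded if $\mathrm{edges}_J(v,w)\neq\emptyset$ for all $v,w\in V(J)$. $J$ is weakly connected if any two vertices are joined by a finite sequence of edges, each traversed in either direction. A loop at $v$ is an edge in $\mathrm{edges}_J(v,v)$. Quiver homomorphisms are pairs of vertex and edge maps commuting with sources and targets. The directed path $P_n$ has vertices $a_1,\dots,a_n$ and edges $x_1,\dots,x_{n-1}$ with $x_k$ from $a_k$ to $a_{k+1}$; the directed cycle $C_n$ has vertices $a_1,\dots,a_n$ and edges $x_1,\dots,x_n$ with $x_k$ from $a_k$ to $a_{k+1}$ for $k<n$ and $x_n$ from $a_n$ to $a_1$. $\phi_n:P_n\to C_n$ is the inclusion. $J$ is $\phi_n$-injective if for every quiver homomorphism $\psi:P_n\to J$ there exists a quiver homomorphism $\hat\psi:C_n\to J$ with $\hat\psi\circ\phi_n=\psi$. -}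

module Defs where

open import Level using (Level; _⊔_)
open import Data.Nat using (ℕ; zero; suc)
open import Data.Fin using (Fin; zero; suc; inject₁; fromℕ)
open import Data.Product using (Σ; ∃; _×_; _,_)
open import Relation.Binary.PropositionalEquality using (_≡_; refl; trans; cong)

record Quiver (a b : Level) : Set (Level.suc (a ⊔ b)) where
  field
    V : Set a
    E : Set b
    σ : E → V
    τ : E → V
open Quiver public

IsEdge : ∀ {a b} (J : Quiver a b) → V J → V J → E J → Set a
IsEdge J v w e = (σ J e ≡ v) × (τ J e ≡ w)

Loaded : ∀ {a b} → Quiver a b → Set (a ⊔ b)
Loaded J = ∀ (v w : V J) → Σ (E J) (IsEdge J v w)

HasLoopAt : ∀ {a b} (J : Quiver a b) → V J → Set (a ⊔ b)
HasLoopAt J v = Σ (E J) (IsEdge J v v)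

data Zigzag {a b} (J : Quiver a b) : V J → V J → Set (a ⊔ b) where
  stay : ∀ {v} → Zigzag J v v
  fwd  : ∀ {u w} (e : E J) → σ J e ≡ u → Zigzag J (τ J e) w → Zigzag J u w
  bwd  : ∀ {u w} (e : E J) → τ J e ≡ u → Zigzag J (σ J e) w → Zigzag J u w

WeaklyConnected : ∀ {a b} → Quiver a b → Set (a ⊔ b)
WeaklyConnected J = ∀ (v w : V J) → Zigzag J v w

record Hom {a b c d} (J : Quiver a b) (K : Quiver c d) : Set (a ⊔ b ⊔ c ⊔ d) where
  field
    vmap : V J → V K
    emap : E J → E K
    σ-comm : ∀ e → σ K (emap e) ≡ vmap (σ J e)
    τ-comm : ∀ e → τ K (emap e) ≡ vmap (τ J e)
open Hom public

-- Directed path P_(suc m): vertices a_1..a_(m+1) as Fin (suc m) (a_(k+1) ↦ k),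
-- edges x_1..x_m as Fin m, x_(k+1) from a_(k+1) to a_(k+2).
Path : ℕ → Quiver Level.zero Level.zero
Path zero    = record { V = Fin zero ; E = Fin zero ; σ = λ () ; τ = λ () }
Path (suc m) = record { V = Fin (suc m) ; E = Fin m ; σ = inject₁ ; τ = suc }

-- cyclic successor on Fin (suc m): k ↦ k+1, last ↦ 0
next : ∀ {m} → Fin (suc m) → Fin (suc m)
next {zero}  zero    = zero
next {suc m} zero    = suc zero
next {suc m} (suc k) with next {m} k
... | zero   = zero
... | suc j  = suc (suc j)

Cycle : ℕ → Quiver Level.zero Level.zero
Cycle zero    = record { V = Fin zero ; E = Fin zero ; σ = λ () ; τ = λ () }
Cycle (suc m) = record { V = Fin (suc m) ; E = Fin (suc m) ; σ = λ k → k ; τ = next }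

φ : (n : ℕ) → Hom (Path n) (Cycle n)
φ zero    = record { vmap = λ () ; emap = λ () ; σ-comm = λ () ; τ-comm = λ () }
φ (suc m) = record { vmap = λ k → k ; emap = inject₁ ; σ-comm = λ _ → _≡_.refl ; τ-comm = next-inject₁ }
  where
  next-inject₁ : ∀ {m} (k : Fin m) → next (inject₁ k) ≡ suc k
  next-inject₁ {suc m} zero = _≡_.refl
  next-inject₁ {suc m} (suc k) rewrite next-inject₁ {m} k = _≡_.refl

_≈Hom_ : ∀ {a b c d} {J : Quiver a b} {K : Quiver c d} → Hom J K → Hom J K → Set (a ⊔ b ⊔ c ⊔ d)
f ≈Hom g = (∀ v → vmap f v ≡ vmap g v) × (∀ e → emap f e ≡ emap g e)

_∘H_ : ∀ {a b c d e f} {I : Quiver a b} {J : Quiver c d} {K : Quiver e f} → Hom J K → Hom I J → Hom I K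
_∘H_ {K = K} g f = record
  { vmap = λ v → vmap g (vmap f v)
  ; emap = λ e → emap g (emap f e)
  ; σ-comm = λ e → Relation.Binary.PropositionalEquality.trans (σ-comm g (emap f e)) (Relation.Binary.PropositionalEquality.cong (vmap g) (σ-comm f e))
  ; τ-comm = λ e → Relation.Binary.PropositionalEquality.trans (τ-comm g (emap f e)) (Relation.Binary.PropositionalEquality.cong (vmap g) (τ-comm f e))
  }
  where import Relation.Binary.PropositionalEquality

PhiInjective : ∀ {a b} → ℕ → Quiver a b → Set (a ⊔ b)
PhiInjective n J = ∀ (ψ : Hom (Path n) J) → Σ (Hom (Cycle n) J) (λ ψ̂ → (ψ̂ ∘H φ n) ≈Hom ψ)

-- A walk of length n - 1 from x to z is a homomorphism P_n → J, and φ_n-injectivity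
-- closes it to a cycle, i.e. yields an edge z → x. Padding with a loop at y turns any
-- x → y → z into such a walk, so through a looped vertex y every two-step path x → y → z
-- is closed by an edge z → x. Hence loops spread along edges in both directions (so along
-- zigzags), and once every vertex has a loop, "edges both ways" is transitive and contains
-- every edge; weak connectivity then makes J loaded.
module Submission where

open import Defs
open import Level using (Level; _⊔_)
open import Data.Nat using (ℕ; _≤_; zero; suc; s≤s; z≤n)
open import Data.Fin using (Fin; zero; suc; inject₁; fromℕ)
open import Data.Product using (_×_; ∃; Σ; _,_; proj₁)
open import Function.Bundles using (_⇔_; mk⇔)
open import Relation.Binary.PropositionalEquality using (_≡_; refl; trans; cong)

next-fromℕ : ∀ m → next (fromℕ m) ≡ zero
next-fromℕ zero    = refl
next-fromℕ (suc m) rewrite next-fromℕ m = refl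

module _ {a b : Level} {J : Quiver a b} where

  Edge : V J → V J → Set (a ⊔ b)
  Edge v w = Σ (E J) (IsEdge J v w)

  edge⇒zigzag : ∀ {v w} → Edge v w → Zigzag J v w
  edge⇒zigzag (e , refl , refl) = fwd e refl stay

  data Walk : ℕ → V J → V J → Set (a ⊔ b) where
    []  : ∀ {x} → Walk zero x x
    _∷_ : ∀ {k x y z} → Edge x y → Walk k y z → Walk (suc k) x z

  vertexAt : ∀ {k x z} → Walk k x z → Fin (suc k) → V J
  vertexAt {x = x} _ zero = x
  vertexAt (_ ∷ w) (suc i) = vertexAt w i

  edgeAt : ∀ {k x z} → Walk k x z → Fin k → E J
  edgeAt ((e , _) ∷ _) zero    = e
  edgeAt (_ ∷ w)       (suc i) = edgeAt w i

  σ-edgeAt : ∀ {k x z} (w : Walk k x z) (i : Fin k) → σ J (edgeAt w i) ≡ vertexAt w (inject₁ i)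
  σ-edgeAt ((_ , eσ , _) ∷ _) zero    = eσ
  σ-edgeAt (_ ∷ w)            (suc i) = σ-edgeAt w i

  τ-edgeAt : ∀ {k x z} (w : Walk k x z) (i : Fin k) → τ J (edgeAt w i) ≡ vertexAt w (suc i)
  τ-edgeAt ((_ , _ , eτ) ∷ _) zero    = eτ
  τ-edgeAt (_ ∷ w)            (suc i) = τ-edgeAt w i

  vertexAt-last : ∀ {k x z} (w : Walk k x z) → vertexAt w (fromℕ k) ≡ z
  vertexAt-last []      = refl
  vertexAt-last (_ ∷ w) = vertexAt-last w

  walk⇒hom : ∀ {k x z} → Walk k x z → Hom (Path (suc k)) J
  walk⇒hom w = record
    { vmap = vertexAt w ; emap = edgeAt w ; σ-comm = σ-edgeAt w ; τ-comm = τ-edgeAt w }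

  phiInjective⇒close-walk : ∀ {k x z} → PhiInjective (suc k) J → Walk k x z → Edge z x
  phiInjective⇒close-walk {k} inj w with inj (walk⇒hom w)
  ... | ψ̂ , vmap-agrees , _ =
    emap ψ̂ (fromℕ k) ,
    trans (σ-comm ψ̂ (fromℕ k)) (trans (vmap-agrees (fromℕ k)) (vertexAt-last w)) ,
    trans (τ-comm ψ̂ (fromℕ k)) (trans (cong (vmap ψ̂) (next-fromℕ k)) (vmap-agrees zero))

  loopThen : ∀ k {y z} → Edge y y → Edge y z → Walk (suc k) y z
  loopThen zero    _ q = q ∷ []
  loopThen (suc k) l q = l ∷ loopThen k l q

  module _ {k : ℕ} (inj : PhiInjective (suc (suc (suc k))) J) where

    close-through-loop : ∀ {x y z} → Edge x y → Edge y y → Edge y z → Edge z x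
    close-through-loop p l q = phiInjective⇒close-walk inj (p ∷ loopThen k l q)

    reverse-into-loop : ∀ {x y} → Edge x y → Edge y y → Edge y x
    reverse-into-loop p l = close-through-loop p l l

    reverse-out-of-loop : ∀ {x y} → Edge x x → Edge x y → Edge y x
    reverse-out-of-loop l q = close-through-loop l l q

    loop-fwd : ∀ {x y} → Edge x x → Edge x y → Edge y y
    loop-fwd l q = close-through-loop (reverse-out-of-loop l q) l q

    loop-bwd : ∀ {x y} → Edge x x → Edge y x → Edge y y
    loop-bwd l p = loop-fwd l (reverse-into-loop p l)

    loop-along-zigzag : ∀ {u w} → Zigzag J u w → Edge u u → Edge w w
    loop-along-zigzag stay            l = l
    loop-along-zigzag (fwd e refl zz) l = loop-along-zigzag zz (loop-fwd l (e , refl , refl))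
    loop-along-zigzag (bwd e refl zz) l = loop-along-zigzag zz (loop-bwd l (e , refl , refl))

    edges-trans : ∀ {x y w} → Edge y y → Edge x y × Edge y x → Edge y w × Edge w y →
                  Edge x w × Edge w x
    edges-trans l (xy , yx) (yw , wy) = close-through-loop wy l yx , close-through-loop xy l yw

    zigzag⇒edges : (∀ v → Edge v v) → ∀ {x w} → Zigzag J x w → Edge x w × Edge w x
    zigzag⇒edges loops {x} stay = loops x , loops x
    zigzag⇒edges loops (fwd e refl zz) =
      edges-trans (loops _) (xy , reverse-into-loop xy (loops _)) (zigzag⇒edges loops zz)
      where xy = (e , refl , refl)
    zigzag⇒edges loops (bwd e refl zz) =
      edges-trans (loops _) (reverse-into-loop yx (loops _) , yx) (zigzag⇒edges loops zz)
      where yx = (e , refl , refl)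

lemma5p4 : ∀ {a b : Level} (n : ℕ) → 3 ≤ n → (J : Quiver a b) → PhiInjective n J → V J →
    Loaded J ⇔ (WeaklyConnected J × ∃ (λ v → HasLoopAt J v))
lemma5p4 .(suc (suc (suc _))) (s≤s (s≤s (s≤s z≤n))) J inj v₀ = mk⇔ to from
  where
  to : Loaded J → WeaklyConnected J × ∃ (λ v → HasLoopAt J v)
  to loaded = (λ v w → edge⇒zigzag (loaded v w)) , v₀ , loaded v₀ v₀

  from : WeaklyConnected J × ∃ (λ v → HasLoopAt J v) → Loaded J
  from (connected , u , loop-u) v w = proj₁ (zigzag⇒edges inj loops (connected v w))
    where
    loops : ∀ v → HasLoopAt J v
    loops v = loop-along-zigzag inj (connected u v) loop-u
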